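{- A graph $G$ is a convex geometry in the $P_4^+$ convexity if and only if $G$ is a cograph (i.e., $G$ has no induced path on four vertices).
   Context: Graphs are finite and simple. In a graph $G$, a set $S\subseteq V(G)$ is $P_4^+$-convex if for every induced path $abcd$ on four vertices of $G$ (edges $ab,bc,cd$ only), if $a,b,d\in S$ then $c\in S$; these are the convex sets of the $P_4^+$ convexity. The convex hull $H(S)$ of $S$ is the smallest convex set containing $S$. A vertex $x$ of a convex set $S$ is an extreme vertex of $S$ if $S\setminus\{x\}$ is convex; $\mathit{ext}(S)$ denotes the set of extreme vertices of $S$. $G$ is a convex geometry (with respect to the convexity) if every convex set $S\subseteq V(G)$ satisfies $S=H(\mathit{ext}(S))$. -}

module Defs where

open import Data.Nat using (ℕ)
open import Data.Fin using (Fin)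
open import Data.Fin.Subset using (Subset; _∈_; _∉_; _⊆_; _-_)
open import Data.Product using (_×_; Σ; ∃)
open import Relation.Nullary using (¬_)
open import Relation.Binary.PropositionalEquality using (_≡_; _≢_)
open import Level using (0ℓ; suc)

record Graph (n : ℕ) : Set₁ where
  field
    Adj    : Fin n → Fin n → Set
    sym    : ∀ {x y} → Adj x y → Adj y x
    irrefl : ∀ {x} → ¬ Adj x x

module _ {n : ℕ} (G : Graph n) where
  open Graph G

  InducedP4 : Fin n → Fin n → Fin n → Fin n → Set
  InducedP4 a b c d =
    (a ≢ b) × (a ≢ c) × (a ≢ d) × (b ≢ c) × (b ≢ d) × (c ≢ d) ×
    Adj a b × Adj b c × Adj c d ×
    ¬ Adj a c × ¬ Adj b d × ¬ Adj a d

  Convex : Subset n → Set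
  Convex S = ∀ a b c d → InducedP4 a b c d →
             a ∈ S → b ∈ S → d ∈ S → c ∈ S

  _∈Hull_ : Fin n → Subset n → Set
  x ∈Hull T = ∀ (C : Subset n) → Convex C → T ⊆ C → x ∈ C

  Extreme : Subset n → Fin n → Set
  Extreme S x = x ∈ S × Convex (S - x)

  -- G is a convex geometry: every convex S equals H(ext(S)).
  -- ext(S) is given as a predicate; H(ext S) is the intersection of all
  -- convex sets containing every extreme vertex of S.
  _∈HullExt_ : Fin n → Subset n → Set
  x ∈HullExt S = ∀ (C : Subset n) → Convex C →
                 (∀ y → Extreme S y → y ∈ C) → x ∈ C

  ConvexGeometry : Set
  ConvexGeometry = ∀ (S : Subset n) → Convex S →
    (∀ x → x ∈ S → x ∈HullExt S) × (∀ x → x ∈HullExt S → x ∈ S)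

  Cograph : Set
  Cograph = ∀ a b c d → ¬ InducedP4 a b c d

-- If abcd is an induced P4, take an inclusion-minimal convex set S containing a, b and d.
-- Then c ∈ S, so b is not extreme (the reversed path dcba forces b back into S - b),
-- and by minimality no vertex other than a and d is extreme either. But {a, d} is
-- convex, so the hull of ext(S) misses b ∈ S. Conversely, in a cograph the convexity
-- condition is vacuous: every set is convex and each of its vertices is extreme.
module Submission where

open import Defs
open import Data.Nat using (ℕ)
open import Data.Product using (_×_; _,_; proj₁)
open import Data.Sum using (_⊎_; inj₁; inj₂)
open import Data.Empty using (⊥; ⊥-elim)
open import Data.Fin using (Fin; _≟_)
open import Data.Fin.Subset using (Subset; _∈_; _∉_; _-_; _─_; ⁅_⁆; _∪_; _⊂_; ⊤; inside)
open import Data.Fin.Subset.Properties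
  using (x∈p∪q⁻; x∈p∪q⁺; x∈⁅y⁆⇒x≡y; x∈⁅x⁆; x∈p∧x≢y⇒x∈p-y; x∈p⇒p-x⊂p; ∈⊤)
open import Data.Fin.Subset.Induction using (⊂-wellFounded)
open import Data.Vec using (_∷_; here; there)
open import Induction.WellFounded using (Acc; acc)
open import Relation.Nullary using (¬_; yes; no)
open import Relation.Binary.PropositionalEquality using (_≡_; _≢_; refl; ≢-sym)

x∈p─q⇒x∉q : ∀ {n} {p q : Subset n} {x} → x ∈ p ─ q → x ∉ q
x∈p─q⇒x∉q {p = _ ∷ p} {inside ∷ q} () here
x∈p─q⇒x∉q {p = _ ∷ p} {_ ∷ q} (there x∈p─q) (there x∈q) = x∈p─q⇒x∉q x∈p─q x∈q

x∉p-x : ∀ {n} (p : Subset n) (x : Fin n) → x ∉ p - x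
x∉p-x p x x∈p-x = x∈p─q⇒x∉q x∈p-x (x∈⁅x⁆ x)

x∈⁅y⁆∪⁅z⁆⁻ : ∀ {n} {x y z : Fin n} → x ∈ ⁅ y ⁆ ∪ ⁅ z ⁆ → x ≡ y ⊎ x ≡ z
x∈⁅y⁆∪⁅z⁆⁻ {y = y} {z} x∈ with x∈p∪q⁻ ⁅ y ⁆ ⁅ z ⁆ x∈
... | inj₁ x∈⁅y⁆ = inj₁ (x∈⁅y⁆⇒x≡y y x∈⁅y⁆)
... | inj₂ x∈⁅z⁆ = inj₂ (x∈⁅y⁆⇒x≡y z x∈⁅z⁆)

x≢y∧x≢z⇒x∉⁅y⁆∪⁅z⁆ : ∀ {n} {x y z : Fin n} → x ≢ y → x ≢ z → x ∉ ⁅ y ⁆ ∪ ⁅ z ⁆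
x≢y∧x≢z⇒x∉⁅y⁆∪⁅z⁆ x≢y x≢z x∈ with x∈⁅y⁆∪⁅z⁆⁻ x∈
... | inj₁ x≡y = x≢y x≡y
... | inj₂ x≡z = x≢z x≡z

x∈⁅x⁆∪⁅y⁆ : ∀ {n} (x y : Fin n) → x ∈ ⁅ x ⁆ ∪ ⁅ y ⁆
x∈⁅x⁆∪⁅y⁆ x y = x∈p∪q⁺ (inj₁ (x∈⁅x⁆ x))

y∈⁅x⁆∪⁅y⁆ : ∀ {n} (x y : Fin n) → y ∈ ⁅ x ⁆ ∪ ⁅ y ⁆
y∈⁅x⁆∪⁅y⁆ x y = x∈p∪q⁺ (inj₂ (x∈⁅x⁆ y))

⁅y⁆∪⁅z⁆-pigeonhole : ∀ {n} {p q r y z : Fin n} → p ≢ q → p ≢ r → q ≢ r →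
                     p ∈ ⁅ y ⁆ ∪ ⁅ z ⁆ → q ∈ ⁅ y ⁆ ∪ ⁅ z ⁆ → r ∈ ⁅ y ⁆ ∪ ⁅ z ⁆ → ⊥
⁅y⁆∪⁅z⁆-pigeonhole p≢q p≢r q≢r p∈ q∈ r∈
  with x∈⁅y⁆∪⁅z⁆⁻ p∈ | x∈⁅y⁆∪⁅z⁆⁻ q∈ | x∈⁅y⁆∪⁅z⁆⁻ r∈
... | inj₁ refl | inj₁ refl | _         = p≢q refl
... | inj₂ refl | inj₂ refl | _         = p≢q refl
... | inj₁ refl | _         | inj₁ refl = p≢r refl
... | inj₂ refl | _         | inj₂ refl = p≢r refl
... | _         | inj₁ refl | inj₁ refl = q≢r refl
... | _         | inj₂ refl | inj₂ refl = q≢r refl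

module _ {n : ℕ} (G : Graph n) where
  open Graph G using () renaming (sym to Adj-sym)

  InducedP4-reverse : ∀ {a b c d} → InducedP4 G a b c d → InducedP4 G d c b a
  InducedP4-reverse (a≢b , a≢c , a≢d , b≢c , b≢d , c≢d , ab , bc , cd , ¬ac , ¬bd , ¬ad) =
    ( ≢-sym c≢d , ≢-sym b≢d , ≢-sym a≢d , ≢-sym b≢c , ≢-sym a≢c , ≢-sym a≢b
    , Adj-sym cd , Adj-sym bc , Adj-sym ab
    , (λ db → ¬bd (Adj-sym db)) , (λ ca → ¬ac (Adj-sym ca)) , (λ da → ¬ad (Adj-sym da)))

  ⁅x⁆∪⁅y⁆-Convex : ∀ x y → Convex G (⁅ x ⁆ ∪ ⁅ y ⁆)
  ⁅x⁆∪⁅y⁆-Convex x y a b c d (a≢b , _ , a≢d , _ , b≢d , _) a∈ b∈ d∈ =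
    ⊥-elim (⁅y⁆∪⁅z⁆-pigeonhole a≢b a≢d b≢d a∈ b∈ d∈)

  InducedP4-inner-¬Extreme : ∀ {S a b c d} → Convex G S → InducedP4 G a b c d →
                             a ∈ S → b ∈ S → d ∈ S → ¬ Extreme G S b
  InducedP4-inner-¬Extreme {S} {c = c} S-convex P@(a≢b , _ , _ , b≢c , b≢d , _)
                           a∈S b∈S d∈S (_ , S-b-convex) =
    x∉p-x S _ (S-b-convex _ _ _ _ (InducedP4-reverse P) (x∈p∧x≢y⇒x∈p-y d∈S (≢-sym b≢d))
                                   (x∈p∧x≢y⇒x∈p-y c∈S (≢-sym b≢c)) (x∈p∧x≢y⇒x∈p-y a∈S a≢b))
    where
    c∈S : c ∈ S
    c∈S = S-convex _ _ _ _ P a∈S b∈S d∈S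

  ⊤-Convex : Convex G ⊤
  ⊤-Convex _ _ _ _ _ _ _ _ = ∈⊤

  Cograph⇒Convex : Cograph G → ∀ S → Convex G S
  Cograph⇒Convex cograph S a b c d P = ⊥-elim (cograph a b c d P)

  Cograph⇒ConvexGeometry : Cograph G → ConvexGeometry G
  Cograph⇒ConvexGeometry cograph S S-convex =
    (λ x x∈S C _ ext⊆C → ext⊆C x (x∈S , Cograph⇒Convex cograph (S - x)))
    , (λ x x∈HullExt → x∈HullExt S S-convex (λ _ → proj₁))

  module _ (geometry : ConvexGeometry G) {a b c d} (P : InducedP4 G a b c d) where

    -- Well-founded induction on ⊂ plays the role of choosing S minimal.
    ¬Convex∋abd : ∀ S → Acc _⊂_ S → Convex G S → a ∈ S → b ∈ S → d ∈ S → ⊥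
    ¬Convex∋abd S (acc smaller) S-convex a∈S b∈S d∈S =
      b∉⁅a⁆∪⁅d⁆ (proj₁ (geometry S S-convex) b b∈S
                   (⁅ a ⁆ ∪ ⁅ d ⁆) (⁅x⁆∪⁅y⁆-Convex a d) Extreme⇒∈⁅a⁆∪⁅d⁆)
      where
      b∉⁅a⁆∪⁅d⁆ : b ∉ ⁅ a ⁆ ∪ ⁅ d ⁆
      b∉⁅a⁆∪⁅d⁆ = let (a≢b , _ , _ , _ , b≢d , _) = P in x≢y∧x≢z⇒x∉⁅y⁆∪⁅z⁆ (≢-sym a≢b) b≢d

      Extreme⇒∈⁅a⁆∪⁅d⁆ : ∀ x → Extreme G S x → x ∈ ⁅ a ⁆ ∪ ⁅ d ⁆
      Extreme⇒∈⁅a⁆∪⁅d⁆ x x-extreme@(x∈S , S-x-convex) with x ≟ a | x ≟ d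
      ... | yes refl | _        = x∈⁅x⁆∪⁅y⁆ a d
      ... | no _     | yes refl = y∈⁅x⁆∪⁅y⁆ a d
      ... | no x≢a   | no x≢d   =
        ⊥-elim (¬Convex∋abd (S - x) (smaller (x∈p⇒p-x⊂p x∈S)) S-x-convex
                  (x∈p∧x≢y⇒x∈p-y a∈S (≢-sym x≢a)) (x∈p∧x≢y⇒x∈p-y b∈S b≢x)
                  (x∈p∧x≢y⇒x∈p-y d∈S (≢-sym x≢d)))
        where
        b≢x : b ≢ x
        b≢x refl = InducedP4-inner-¬Extreme S-convex P a∈S b∈S d∈S x-extreme

  ConvexGeometry⇒Cograph : ConvexGeometry G → Cograph G
  ConvexGeometry⇒Cograph geometry a b c d P =
    ¬Convex∋abd geometry P ⊤ (⊂-wellFounded ⊤) ⊤-Convex ∈⊤ ∈⊤ ∈⊤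

mainTheorem6 : ∀ (n : ℕ) (G : Graph n) →
    (ConvexGeometry G → Cograph G) × (Cograph G → ConvexGeometry G)
mainTheorem6 n G = ConvexGeometry⇒Cograph G , Cograph⇒ConvexGeometry G
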